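{- For each nonnegative integer $s$ and each positive integer $b$, $\tau_{s}(s+2,b) = 1$ if and only if $(s+2)^{s+2} \leq b \leq \binom{s+3}{2}(s+3)^{s+1}-1$.
   Context: All graphs are finite and simple. For graphs $G,H$ on disjoint vertex sets, the join $G \vee H$ is the graph consisting of $G$, $H$, and all edges joining a vertex of $G$ to a vertex of $H$; $K_n$ is the complete graph on $n$ vertices, and $K_0 \vee G$ is understood as $G$. $K_{a,b}$ is the complete bipartite graph with partite sets of sizes $a$ and $b$. $\chi$ denotes chromatic number and $\chi_\ell$ list chromatic number. For a nonnegative integer $s$ and positive integers $a,b$, $\tau_s(a,b)$ denotes the smallest nonnegative integer $n$ such that $\chi_\ell(K_n \vee K_{a,b}) - \chi(K_n \vee K_{a,b}) \leq s$. -}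

module Defs where

open import Data.Nat using (ℕ; _+_; _*_; _∸_; _^_; _≤_; _<_)
open import Data.Nat.Combinatorics using (_C_)
open import Data.Fin using (Fin; splitAt)
open import Data.Sum using (_⊎_; inj₁; inj₂)
open import Data.Product using (Σ; _×_; ∃; ∃-syntax)
open import Data.Unit using (⊤)
open import Data.Empty using (⊥)
open import Data.List using (List; length)
open import Data.List.Membership.Propositional using (_∈_)
open import Data.List.Relation.Unary.Unique.Propositional using (Unique)
open import Relation.Nullary using (¬_)
open import Relation.Binary.PropositionalEquality using (_≡_; _≢_)

record Graph : Set₁ where
  field
    size : ℕ
    Adj  : Fin size → Fin size → Set
open Graph public

K : ℕ → Graph
K n = record { size = n ; Adj = λ x y → x ≢ y }

E : ℕ → Graph
E n = record { size = n ; Adj = λ _ _ → ⊥ }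

joinAdj : ∀ {m n} → (Fin m → Fin m → Set) → (Fin n → Fin n → Set)
        → Fin m ⊎ Fin n → Fin m ⊎ Fin n → Set
joinAdj A B (inj₁ x) (inj₁ y) = A x y
joinAdj A B (inj₂ x) (inj₂ y) = B x y
joinAdj A B (inj₁ _) (inj₂ _) = ⊤
joinAdj A B (inj₂ _) (inj₁ _) = ⊤

_∨G_ : Graph → Graph → Graph
G ∨G H = record
  { size = size G + size H
  ; Adj  = λ u v → joinAdj (Adj G) (Adj H) (splitAt (size G) u) (splitAt (size G) v) }

Kbip : ℕ → ℕ → Graph
Kbip a b = E a ∨G E b

Proper : (G : Graph) {C : Set} → (Fin (size G) → C) → Set
Proper G c = ∀ u v → Adj G u v → c u ≢ c v

Colorable : Graph → ℕ → Set
Colorable G k = Σ (Fin (size G) → Fin k) (Proper G)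

IsChromaticNumber : Graph → ℕ → Set
IsChromaticNumber G k = Colorable G k × (∀ j → Colorable G j → k ≤ j)

Choosable : Graph → ℕ → Set
Choosable G k =
  (L : Fin (size G) → List ℕ) →
  (∀ v → Unique (L v)) → (∀ v → length (L v) ≡ k) →
  Σ (Fin (size G) → ℕ) λ c → Proper G c × (∀ v → c v ∈ L v)

IsListChromaticNumber : Graph → ℕ → Set
IsListChromaticNumber G k = Choosable G k × (∀ j → Choosable G j → k ≤ j)

GapAtMost : ℕ → Graph → Set
GapAtMost s G = ∃[ x ] ∃[ l ] (IsChromaticNumber G x × IsListChromaticNumber G l × l ≤ x + s)

IsTau : ℕ → ℕ → ℕ → ℕ → Set
IsTau s a b t = GapAtMost s (K t ∨G Kbip a b)
              × (∀ m → m < t → ¬ GapAtMost s (K m ∨G Kbip a b))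

-- Write a = s + 2. For b ≥ 1, χ(K_{a,b}) = 2 and χ(K_1 ∨ K_{a,b}) = 3, so τ_s(a,b) = 1 says exactly
-- that K_{a,b} is not a-choosable while K_1 ∨ K_{a,b} is (a+1)-choosable.
--
-- K_{a,b} is a-choosable iff b < a^a. If two lists on the a-side meet, that side can be coloured with
-- fewer than a colours; otherwise its a^a transversals are pairwise different a-sets, and one of them
-- is none of the b lists on the other side, so every vertex there keeps a free colour. Conversely the
-- a^a lists {(k, h k) | k < a}, h : a → a, on the b-side block every choice from the lists {(k, r) | r < a}.
--
-- K_1 ∨ K_{a,b} is (a+1)-choosable iff b < C(a+1,2)·(a+1)^(a-1). With disjoint lists on the a-side,
-- pick the colour w of the apex z and then, from the (at most one) a-list containing w, one of its
-- other a colours, and anything from the other lists: these (a+1)·a·(a+1)^(a-1) configurations give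
-- (a+1)-sets each arising at most twice, so for 2b below that count one of them is no list of the
-- b-side. Conversely, give z the same list as x₀; the lists made of two colours of that common row and
-- one colour of every other row block every colouring.

module Submission where

open import Data.Nat using (ℕ; zero; suc; _+_; _*_; _∸_; _^_; _⊓_; _≤_; _<_; z≤n; s≤s; s≤s⁻¹; NonZero)
open import Data.Nat.Combinatorics using (_C_; nC1≡n; nCk+nC[k+1]≡[n+1]C[k+1])
open import Data.Nat.DivMod using (_%_; _mod_; m<n⇒m%n≡m)
open import Data.Nat.Properties
open import Data.Empty using (⊥-elim)
open import Data.Fin as Fin using
  (Fin; zero; suc; toℕ; _↑ˡ_; _↑ʳ_; splitAt; punchIn; punchOut; inject≤; combine; remQuot; finToFun; funToFin)
import Data.Fin.Properties as Finₚ
open import Data.List using (List; []; _∷_; length; lookup; tabulate; take)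
open import Data.List.Properties using (length-tabulate; length-take)
open import Data.List.Membership.Propositional using (_∈_; _∉_; find; lose)
open import Data.List.Membership.Propositional.Properties using (∈-lookup; ∈-tabulate⁺; ∈-tabulate⁻)
open import Data.List.Membership.DecPropositional _≟_ using (_∈?_)
open import Data.List.Relation.Binary.Sublist.Propositional as Sublist using ()
open import Data.List.Relation.Binary.Sublist.Propositional.Properties using (take-⊆)
open import Data.List.Relation.Binary.Subset.DecPropositional _≟_ using (_⊆_; _⊆?_)
open import Data.List.Relation.Unary.All as All using (All)
open import Data.List.Relation.Unary.AllPairs using (_∷_)
open import Data.List.Relation.Unary.Any as Any using (here; there; any?)
open import Data.List.Relation.Unary.Any.Properties using (lookup-index)
open import Data.List.Relation.Unary.Unique.Propositional using (Unique)
open import Data.List.Relation.Unary.Unique.Propositional.Properties using (tabulate⁺; take⁺)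
open import Data.Product as Product using (Σ; _×_; _,_; ∃; ∃₂; proj₁; proj₂)
open import Data.Sum as Sum using (_⊎_; inj₁; inj₂; [_,_]′)
open import Data.Unit using (tt)
open import Data.Vec.Functional using (insertAt)
open import Data.Vec.Functional.Properties using (insertAt-lookup; insertAt-punchIn)
open import Function using (_∘_; id)
open import Function.Bundles using (_⇔_; mk⇔)
open import Function.Definitions using (Injective)
open import Relation.Binary.PropositionalEquality
open import Relation.Nullary using (¬_; Dec; yes; no; contradiction)
open import Relation.Nullary.Decidable using (_×-dec_; ¬?; decidable-stable; ¬¬-excluded-middle)

open import Defs

-- Duplicate-free lists as finite sets

_⊈_ : List ℕ → List ℕ → Set
xs ⊈ ys = ∃ λ x → x ∈ xs × x ∉ ys

_≋_ : List ℕ → List ℕ → Set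
xs ≋ ys = xs ⊆ ys × ys ⊆ xs

⊈-or-⊆ : ∀ xs ys → xs ⊈ ys ⊎ xs ⊆ ys
⊈-or-⊆ xs ys with any? (λ x → ¬? (x ∈? ys)) xs
... | yes outside = inj₁ (find outside)
... | no ¬outside = inj₂ λ {x} x∈xs → decidable-stable (x ∈? ys) (¬outside ∘ lose x∈xs)

lookup-injective : ∀ {xs : List ℕ} → Unique xs → ∀ {i j} → lookup xs i ≡ lookup xs j → i ≡ j
lookup-injective {_ ∷ _} _             {zero}  {zero}  _  = refl
lookup-injective {_ ∷ _} (x∉xs ∷ _)    {zero}  {suc j} eq = contradiction eq (All.lookup x∉xs (∈-lookup j))
lookup-injective {_ ∷ _} (x∉xs ∷ _)    {suc i} {zero}  eq = contradiction (sym eq) (All.lookup x∉xs (∈-lookup i))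
lookup-injective {_ ∷ _} (_ ∷ unique)  {suc i} {suc j} eq = cong suc (lookup-injective unique eq)

unique-⊆⇒length≤ : ∀ {xs ys} → Unique xs → xs ⊆ ys → length xs ≤ length ys
unique-⊆⇒length≤ {xs} {ys} unique xs⊆ys = ≮⇒≥ λ ys<xs →
  let i , j , i<j , same = Finₚ.pigeonhole ys<xs position
  in Finₚ.<⇒≢ i<j (lookup-injective unique (begin
       lookup xs i              ≡⟨ lookup-index (xs⊆ys (∈-lookup i)) ⟩
       lookup ys (position i)   ≡⟨ cong (lookup ys) same ⟩
       lookup ys (position j)   ≡⟨ lookup-index (xs⊆ys (∈-lookup j)) ⟨
       lookup xs j              ∎))
  where
  open ≡-Reasoning
  position : Fin (length xs) → Fin (length ys)
  position i = Any.index (xs⊆ys (∈-lookup i))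

⊈-of-length< : ∀ {xs ys} → Unique xs → length ys < length xs → xs ⊈ ys
⊈-of-length< {xs} {ys} unique ys<xs with ⊈-or-⊆ xs ys
... | inj₁ xs⊈ys = xs⊈ys
... | inj₂ xs⊆ys = contradiction (unique-⊆⇒length≤ unique xs⊆ys) (<⇒≱ ys<xs)

⊆-of-length≤ : ∀ {xs ys} → Unique xs → xs ⊆ ys → length ys ≤ length xs → ys ⊆ xs
⊆-of-length≤ {xs} {ys} unique xs⊆ys ys≤xs {y} y∈ys with y ∈? xs
... | yes y∈xs = y∈xs
... | no  y∉xs = contradiction (unique-⊆⇒length≤ (y-fresh ∷ unique) y∷xs⊆ys) (<⇒≱ (s≤s ys≤xs))
  where
  y-fresh : All (y ≢_) xs
  y-fresh = All.tabulate λ { x∈xs refl → y∉xs x∈xs }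
  y∷xs⊆ys : (y ∷ xs) ⊆ ys
  y∷xs⊆ys (here refl)  = y∈ys
  y∷xs⊆ys (there x∈xs) = xs⊆ys x∈xs

enumerate : ∀ {n} (xs : List ℕ) → length xs ≡ n → Fin n → ℕ
enumerate xs refl = lookup xs

enumerate-∈ : ∀ {n} xs (len : length xs ≡ n) i → enumerate xs len i ∈ xs
enumerate-∈ xs refl = ∈-lookup

enumerate-injective : ∀ {n xs} (len : length xs ≡ n) → Unique xs → Injective _≡_ _≡_ (enumerate xs len)
enumerate-injective refl = lookup-injective

funToFin-cong : ∀ {m n} {f g : Fin m → Fin n} → (∀ i → f i ≡ g i) → funToFin f ≡ funToFin g
funToFin-cong {zero}  f≗g = refl
funToFin-cong {suc m} f≗g = cong₂ combine (f≗g zero) (funToFin-cong (f≗g ∘ suc))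

finToFun-injective : ∀ {m n} {u v : Fin (m ^ n)} → (∀ i → finToFun {m} {n} u i ≡ finToFun v i) → u ≡ v
finToFun-injective {m} {n} {u} {v} u≗v = trans (sym (Finₚ.funToFin-finToFin {n} {m} u))
  (trans (funToFin-cong {n} {m} u≗v) (Finₚ.funToFin-finToFin {n} {m} v))

remQuot₃ : ∀ {a b} c → Fin (a * (b * c)) → Fin a × Fin b × Fin c
remQuot₃ {a} {b} c u = Product.map₂ (remQuot {b} c) (remQuot {a} (b * c) u)

remQuot₃-injective : ∀ {a b} c {u v : Fin (a * (b * c))} → remQuot₃ c u ≡ remQuot₃ c v → u ≡ v
remQuot₃-injective {a} {b} c {u} {v} eq =
  trans (sym (combine₃-remQuot₃ u)) (trans (cong combine₃ eq) (combine₃-remQuot₃ v))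
  where
  combine₃ : Fin a × Fin b × Fin c → Fin (a * (b * c))
  combine₃ (i , j , k) = combine i (combine j k)
  combine₃-remQuot₃ : ∀ u → combine₃ (remQuot₃ c u) ≡ u
  combine₃-remQuot₃ u = trans (cong (combine (proj₁ (remQuot {a} (b * c) u))) (Finₚ.combine-remQuot {b} c _))
                              (Finₚ.combine-remQuot {a} (b * c) u)

insertAt-injective : ∀ {n} {A : Set} (xs ys : Fin n → A) i {x y} →
                     (∀ k → insertAt xs i x k ≡ insertAt ys i y k) → x ≡ y × (∀ k → xs k ≡ ys k)
insertAt-injective xs ys i {x} {y} same =
  trans (sym (insertAt-lookup xs i x)) (trans (same i) (insertAt-lookup ys i y)) ,
  λ k → trans (sym (insertAt-punchIn xs i x k)) (trans (same (punchIn i k)) (insertAt-punchIn ys i y k))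

-- Lets a family indexed by Fin N be spread over b ≥ N vertices.
clamp : ∀ {N b} .{{_ : NonZero N}} → Fin b → Fin N
clamp {N} l = toℕ l mod N

clamp-inject≤ : ∀ {N b} .{{_ : NonZero N}} (u : Fin N) (N≤b : N ≤ b) → clamp (inject≤ u N≤b) ≡ u
clamp-inject≤ {N} u N≤b = Finₚ.toℕ-injective (begin
  toℕ (clamp (inject≤ u N≤b))   ≡⟨ Finₚ.toℕ-fromℕ< _ ⟩
  toℕ (inject≤ u N≤b) % N       ≡⟨ cong (_% N) (Finₚ.toℕ-inject≤ u N≤b) ⟩
  toℕ u % N                     ≡⟨ m<n⇒m%n≡m (Finₚ.toℕ<n u) ⟩
  toℕ u                         ∎)
  where open ≡-Reasoning

nⁿ≢0 : ∀ n → NonZero (n ^ n)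
nⁿ≢0 zero    = _
nⁿ≢0 (suc n) = m^n≢0 (suc n) (suc n)

-- The colour (i, j) of the header; opaque so that unification sees `cell i j`, not its unfolding.
opaque
  cell : ∀ {m n} → Fin m → Fin n → ℕ
  cell i j = toℕ (combine i j)

  cell-injective : ∀ {m n} {i k : Fin m} {j l : Fin n} → cell i j ≡ cell k l → i ≡ k × j ≡ l
  cell-injective eq = Finₚ.combine-injective _ _ _ _ (Finₚ.toℕ-injective eq)

Collision₃ : ∀ {n m} → (Fin n → Fin m) → Set
Collision₃ {n} f = ∃ λ (i : Fin n) → ∃₂ λ j k → i ≢ j × i ≢ k × j ≢ k × f i ≡ f j × f i ≡ f k

skip₂ : ∀ {n} {i j : Fin (2 + n)} → i ≢ j → Fin n → Fin (2 + n)
skip₂ {i = i} i≢j x = punchIn i (punchIn (punchOut i≢j) x)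

skip₂-injective : ∀ {n} {i j : Fin (2 + n)} (i≢j : i ≢ j) → Injective _≡_ _≡_ (skip₂ i≢j)
skip₂-injective {i = i} i≢j = Finₚ.punchIn-injective (punchOut i≢j) _ _ ∘ Finₚ.punchIn-injective i _ _

skip₂-≢ˡ : ∀ {n} {i j : Fin (2 + n)} (i≢j : i ≢ j) x → i ≢ skip₂ i≢j x
skip₂-≢ˡ {i = i} i≢j x = Finₚ.punchInᵢ≢i i _ ∘ sym

skip₂-≢ʳ : ∀ {n} {i j : Fin (2 + n)} (i≢j : i ≢ j) x → j ≢ skip₂ i≢j x
skip₂-≢ʳ {i = i} i≢j x eq = Finₚ.punchInᵢ≢i (punchOut i≢j) x
  (Finₚ.punchIn-injective i _ _ (trans (sym eq) (sym (Finₚ.punchIn-punchOut i≢j))))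

pigeonhole₃ : ∀ {m n} → 2 * m < n → (f : Fin n → Fin m) → Collision₃ f
pigeonhole₃ {zero}  {suc n} _ f = contradiction (f zero) λ ()
pigeonhole₃ {suc m} {suc zero} (s≤s ())
pigeonhole₃ {suc m} {suc (suc n)} 2m<n f
  with i , j , i<j , fi≡fj ← Finₚ.pigeonhole (≤-<-trans (m≤m+n (suc m) _) 2m<n) f
  with i≢j ← Finₚ.<⇒≢ i<j
  with Finₚ.any? (λ x → f i Fin.≟ f (skip₂ i≢j x))
... | yes (x , hit) = i , j , skip₂ i≢j x , i≢j , skip₂-≢ˡ i≢j x , skip₂-≢ʳ i≢j x , fi≡fj , hit
... | no miss
  with 2m<n-2 ← subst (_≤ n) (+-suc m (m + 0)) (s≤s⁻¹ (s≤s⁻¹ 2m<n))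
  with x , y , z , x≢y , x≢z , y≢z , gx≡gy , gx≡gz ← pigeonhole₃ 2m<n-2 (λ x → punchOut (miss ∘ (x ,_)))
  = skip₂ i≢j x , skip₂ i≢j y , skip₂ i≢j z
  , x≢y ∘ skip₂-injective i≢j , x≢z ∘ skip₂-injective i≢j , y≢z ∘ skip₂-injective i≢j
  , Finₚ.punchOut-injective {i = f i} _ _ gx≡gy , Finₚ.punchOut-injective {i = f i} _ _ gx≡gz

pairs : ℕ → ℕ
pairs zero    = 0
pairs (suc n) = n + pairs n

pairs≡C2 : ∀ n → pairs n ≡ n C 2
pairs≡C2 zero    = refl
pairs≡C2 (suc n) = trans (cong₂ _+_ (sym (nC1≡n n)) (pairs≡C2 n)) (nCk+nC[k+1]≡[n+1]C[k+1] n 1)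

double-pairs : ∀ n → 2 * pairs (suc n) ≡ suc n * n
double-pairs zero    = refl
double-pairs (suc n) = begin
  2 * (suc n + pairs (suc n))     ≡⟨ *-distribˡ-+ 2 (suc n) (pairs (suc n)) ⟩
  2 * suc n + 2 * pairs (suc n)   ≡⟨ cong₂ _+_ (*-comm 2 (suc n)) (double-pairs n) ⟩
  suc n * 2 + suc n * n           ≡⟨ *-distribˡ-+ (suc n) 2 n ⟨
  suc n * (2 + n)                 ≡⟨ *-comm (suc n) (2 + n) ⟩
  (2 + n) * suc n                 ∎
  where open ≡-Reasoning

pair : ∀ n → Fin (pairs n) → Fin n × Fin n
pair (suc n) = [ (λ q → zero , suc q) , Product.map suc suc ∘ pair n ]′ ∘ splitAt n

pair-distinct : ∀ n (u : Fin (pairs n)) → proj₁ (pair n u) ≢ proj₂ (pair n u)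
pair-distinct (suc n) u with splitAt n u
... | inj₁ q  = λ ()
... | inj₂ u′ = pair-distinct n u′ ∘ Finₚ.suc-injective

pair-surjective : ∀ {n} {p q : Fin n} → p ≢ q → ∃ λ u → pair n u ≡ (p , q) ⊎ pair n u ≡ (q , p)
pair-surjective {suc n} {zero}  {zero}  0≢0 = contradiction refl 0≢0
pair-surjective {suc n} {zero}  {suc q} _ = q ↑ˡ pairs n , inj₁ (cong [ _ , _ ]′ (Finₚ.splitAt-↑ˡ n q _))
pair-surjective {suc n} {suc p} {zero}  _ = p ↑ˡ pairs n , inj₂ (cong [ _ , _ ]′ (Finₚ.splitAt-↑ˡ n p _))
pair-surjective {suc n} {suc p} {suc q} p≢q
  with u , eq ← pair-surjective (p≢q ∘ cong suc)
  = n ↑ʳ u , Sum.map shift shift eq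
  where
  shift : ∀ {x} → pair n u ≡ x → pair (suc n) (n ↑ʳ u) ≡ Product.map suc suc x
  shift eq = trans (cong [ _ , _ ]′ (Finₚ.splitAt-↑ʳ n (pairs n) u)) (cong (Product.map suc suc) eq)

module _ {N b} (S : Fin N → List ℕ) (Ly : Fin b → List ℕ) where

  Covered : Set
  Covered = ∀ u → ∃ λ l → Ly l ⊆ S u

  uncovered : ¬ Covered → ∃ λ u → ∀ l → Ly l ⊈ S u
  uncovered ¬covered
    with u , ¬∃ ← Finₚ.¬∀⟶∃¬ N _ (λ u → Finₚ.any? λ l → Ly l ⊆? S u) ¬covered
    = u , λ l → [ id , (λ Ly⊆S → contradiction (l , Ly⊆S) ¬∃) ]′ (⊈-or-⊆ (Ly l) (S u))

  module _ (Ly-unique : ∀ l → Unique (Ly l)) (S-short : ∀ u l → length (S u) ≤ length (Ly l)) where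

    covered-≋ : ∀ {l u v} → Ly l ⊆ S u → Ly l ⊆ S v → S u ≋ S v
    covered-≋ {l} {u} {v} ⊆Su ⊆Sv =
      ⊆Sv ∘ ⊆-of-length≤ (Ly-unique l) ⊆Su (S-short u l) ,
      ⊆Su ∘ ⊆-of-length≤ (Ly-unique l) ⊆Sv (S-short v l)

    covered-by-same : (covered : Covered) → ∀ {u v} → proj₁ (covered u) ≡ proj₁ (covered v) → S u ≋ S v
    covered-by-same covered {u} {v} same =
      covered-≋ (proj₂ (covered u)) (subst (λ l → Ly l ⊆ S v) (sym same) (proj₂ (covered v)))

    uncovered-of-injective : b < N → (∀ {u v} → S u ≋ S v → u ≡ v) → ∃ λ u → ∀ l → Ly l ⊈ S u
    uncovered-of-injective b<N S-injective = uncovered λ covered →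
      let u , v , u<v , same = Finₚ.pigeonhole b<N (proj₁ ∘ covered)
      in Finₚ.<⇒≢ u<v (S-injective (covered-by-same covered same))

    uncovered-of-two-to-one : 2 * b < N →
                              (∀ {u v w} → S u ≋ S v → S u ≋ S w → u ≡ v ⊎ u ≡ w ⊎ v ≡ w) →
                              ∃ λ u → ∀ l → Ly l ⊈ S u
    uncovered-of-two-to-one 2b<N S-two-to-one = uncovered λ covered →
      let u , v , w , u≢v , u≢w , v≢w , same-v , same-w = pigeonhole₃ 2b<N (proj₁ ∘ covered)
      in [ u≢v , [ u≢w , v≢w ]′ ]′
           (S-two-to-one (covered-by-same covered same-v) (covered-by-same covered same-w))

module _ {a n} (X : Fin a → Fin n → ℕ) where

  RowsOverlap : Set
  RowsOverlap = ∃₂ λ k k′ → k ≢ k′ × ∃₂ λ p p′ → X k p ≡ X k′ p′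

  RowsDisjoint : Set
  RowsDisjoint = ∀ {k k′ p p′} → X k p ≡ X k′ p′ → k ≡ k′

  overlap-or-disjoint : RowsOverlap ⊎ RowsDisjoint
  overlap-or-disjoint
    with Finₚ.any? (λ k → Finₚ.any? λ k′ →
           ¬? (k Fin.≟ k′) ×-dec (Finₚ.any? λ p → Finₚ.any? λ p′ → X k p ≟ X k′ p′))
  ... | yes rows-meet = inj₁ rows-meet
  ... | no ¬rows-meet = inj₂ λ {k} {k′} eq →
    decidable-stable (k Fin.≟ k′) λ k≢k′ → ¬rows-meet (k , k′ , k≢k′ , _ , _ , eq)

  transversal : (Fin a → Fin n) → List ℕ
  transversal ch = tabulate λ k → X k (ch k)

  length-transversal : ∀ ch → length (transversal ch) ≡ a
  length-transversal ch = length-tabulate _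

  ∈-transversal⁺ : ∀ ch k → X k (ch k) ∈ transversal ch
  ∈-transversal⁺ ch = ∈-tabulate⁺

  ∈-transversal⁻ : ∀ ch {x} → x ∈ transversal ch → ∃ λ k → x ≡ X k (ch k)
  ∈-transversal⁻ ch = ∈-tabulate⁻

  transversal-injective : (∀ k → Injective _≡_ _≡_ (X k)) → RowsDisjoint →
                          ∀ {ch ch′} → transversal ch ⊆ transversal ch′ → ∀ k → ch k ≡ ch′ k
  transversal-injective X-injective disjoint ⊆ch′ k
    with k′ , eq ← ∈-transversal⁻ _ (⊆ch′ (∈-transversal⁺ _ k))
    with refl ← disjoint eq
    = X-injective k eq

overlap⇒short-transversal : ∀ {a n} (X : Fin a → Fin n → ℕ) → RowsOverlap X →
                            ∃₂ λ (ch : Fin a → Fin n) T → length T < a × (∀ k → X k (ch k) ∈ T)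
overlap⇒short-transversal {suc a} X (k , k′ , k≢k′ , p , p′ , eq) =
  ch , T , s≤s (≤-reflexive (length-tabulate _)) , ∈T
  where
  ch : Fin (suc a) → Fin _
  ch j with j Fin.≟ k
  ... | yes _ = p
  ... | no  _ = p′
  T : List ℕ
  T = tabulate λ i → X (punchIn k i) p′
  ∈T-away : ∀ {j} → k ≢ j → X j p′ ∈ T
  ∈T-away k≢j = subst (λ j → X j p′ ∈ T) (Finₚ.punchIn-punchOut k≢j) (∈-tabulate⁺ (punchOut k≢j))
  ∈T : ∀ j → X j (ch j) ∈ T
  ∈T j with j Fin.≟ k
  ... | yes refl = subst (_∈ T) (sym eq) (∈T-away k≢k′)
  ... | no  j≢k  = ∈T-away (j≢k ∘ sym)

2≤-of-≢ : ∀ {j} {p q : Fin j} → p ≢ q → 2 ≤ j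
2≤-of-≢ {suc zero}    {zero} {zero} p≢q = contradiction refl p≢q
2≤-of-≢ {suc (suc j)} _ = s≤s (s≤s z≤n)

3≤-of-≢ : ∀ {j} {p q r : Fin j} → p ≢ q → p ≢ r → q ≢ r → 3 ≤ j
3≤-of-≢ {suc j} p≢q p≢r q≢r = s≤s (2≤-of-≢ (q≢r ∘ Finₚ.punchOut-injective p≢q p≢r))

chromatic-unique : ∀ {G x y} → IsChromaticNumber G x → IsChromaticNumber G y → x ≡ y
chromatic-unique (colourable-x , least-x) (colourable-y , least-y) =
  ≤-antisym (least-x _ colourable-y) (least-y _ colourable-x)

choosable-mono : ∀ {G k k′} → k ≤ k′ → Choosable G k → Choosable G k′
choosable-mono {k = k} k≤k′ choosable L unique length≡ =
  let c , proper , chosen = choosable (take k ∘ L) (take⁺ k ∘ unique) shortened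
  in c , proper , λ v → Sublist.lookup (take-⊆ k (L v)) (chosen v)
  where
  shortened : ∀ v → length (take k (L v)) ≡ k
  shortened v = trans (length-take k (L v)) (trans (cong (k ⊓_) (length≡ v)) (m≤n⇒m⊓n≡m k≤k′))

listChromatic-of-least : ∀ {G k} → Choosable G (suc k) → ¬ Choosable G k → IsListChromaticNumber G (suc k)
listChromatic-of-least choosable ¬choosable =
  choosable , λ j choosable-j → ≮⇒≥ λ j<1+k → ¬choosable (choosable-mono (s≤s⁻¹ j<1+k) choosable-j)

-- Choosability is not decidable, so the least choosable size exists only under double negation.
listChromatic-exists : ∀ {G k} → Choosable G k → ¬ ¬ (∃ λ l → IsListChromaticNumber G l × l ≤ k)
listChromatic-exists {k = zero} choosable none = none (0 , (choosable , λ _ _ → z≤n) , z≤n)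
listChromatic-exists {k = suc k} choosable none = ¬¬-excluded-middle λ
  { (yes choosable-k) →
      listChromatic-exists choosable-k λ (l , χℓ , l≤k) → none (l , χℓ , m≤n⇒m≤1+n l≤k)
  ; (no ¬choosable-k) → none (suc k , listChromatic-of-least choosable ¬choosable-k , ≤-refl) }

gap⇒choosable : ∀ {G x s} → IsChromaticNumber G x → GapAtMost s G → Choosable G (x + s)
gap⇒choosable {s = s} χ (x′ , l , χ′ , (choosable , _) , l≤x′+s) =
  choosable-mono (subst (λ y → _ ≤ y + s) (chromatic-unique χ′ χ) l≤x′+s) choosable

choosable⇒¬¬gap : ∀ {G x s} → IsChromaticNumber G x → Choosable G (x + s) → ¬ ¬ GapAtMost s G
choosable⇒¬¬gap χ choosable ¬gap =
  listChromatic-exists choosable λ (l , χℓ , l≤) → ¬gap (_ , l , χ , χℓ , l≤)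

-- The join K_t ∨ K_{a,b}, with vertices z i, x k and y l

module Join (t a b : ℕ) where

  G : Graph
  G = K t ∨G Kbip a b

  zv : Fin t → Fin (size G)
  zv i = i ↑ˡ (a + b)

  xv : Fin a → Fin (size G)
  xv k = t ↑ʳ (k ↑ˡ b)

  yv : Fin b → Fin (size G)
  yv l = t ↑ʳ (a ↑ʳ l)

  vertex-elim : (P : Fin (size G) → Set) →
                (∀ i → P (zv i)) → (∀ k → P (xv k)) → (∀ l → P (yv l)) → ∀ v → P v
  vertex-elim P Pz Px Py v with splitAt t v in eq
  ... | inj₁ i = subst P (Finₚ.splitAt⁻¹-↑ˡ eq) (Pz i)
  ... | inj₂ w with splitAt a w in eq′
  ...   | inj₁ k = subst P (trans (cong (t ↑ʳ_) (Finₚ.splitAt⁻¹-↑ˡ eq′)) (Finₚ.splitAt⁻¹-↑ʳ eq)) (Px k)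
  ...   | inj₂ l = subst P (trans (cong (t ↑ʳ_) (Finₚ.splitAt⁻¹-↑ʳ eq′)) (Finₚ.splitAt⁻¹-↑ʳ eq)) (Py l)

  adj-zz : ∀ {i j} → i ≢ j → Adj G (zv i) (zv j)
  adj-zz {i} {j} rewrite Finₚ.splitAt-↑ˡ t i (a + b) | Finₚ.splitAt-↑ˡ t j (a + b) = id

  adj-zx : ∀ i k → Adj G (zv i) (xv k)
  adj-zx i k rewrite Finₚ.splitAt-↑ˡ t i (a + b) | Finₚ.splitAt-↑ʳ t (a + b) (k ↑ˡ b) = tt

  adj-zy : ∀ i l → Adj G (zv i) (yv l)
  adj-zy i l rewrite Finₚ.splitAt-↑ˡ t i (a + b) | Finₚ.splitAt-↑ʳ t (a + b) (a ↑ʳ l) = tt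

  adj-xy : ∀ k l → Adj G (xv k) (yv l)
  adj-xy k l rewrite Finₚ.splitAt-↑ʳ t (a + b) (k ↑ˡ b) | Finₚ.splitAt-↑ʳ t (a + b) (a ↑ʳ l)
                   | Finₚ.splitAt-↑ˡ a k b | Finₚ.splitAt-↑ʳ a b l = tt

  fromParts : {C : Set} → (Fin t → C) → (Fin a → C) → (Fin b → C) → Fin (size G) → C
  fromParts cz cx cy = [ cz , [ cx , cy ]′ ∘ splitAt a ]′ ∘ splitAt t

  module _ {C : Set} (cz : Fin t → C) (cx : Fin a → C) (cy : Fin b → C) where

    fromParts-zv : ∀ i → fromParts cz cx cy (zv i) ≡ cz i
    fromParts-zv i rewrite Finₚ.splitAt-↑ˡ t i (a + b) = refl

    fromParts-xv : ∀ k → fromParts cz cx cy (xv k) ≡ cx k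
    fromParts-xv k rewrite Finₚ.splitAt-↑ʳ t (a + b) (k ↑ˡ b) | Finₚ.splitAt-↑ˡ a k b = refl

    fromParts-yv : ∀ l → fromParts cz cx cy (yv l) ≡ cy l
    fromParts-yv l rewrite Finₚ.splitAt-↑ʳ t (a + b) (a ↑ʳ l) | Finₚ.splitAt-↑ʳ a b l = refl

    fromParts-all : (P : C → Set) → (∀ i → P (cz i)) → (∀ k → P (cx k)) → (∀ l → P (cy l)) →
                    ∀ v → P (fromParts cz cx cy v)
    fromParts-all P Pz Px Py v with splitAt t v
    ... | inj₁ i = Pz i
    ... | inj₂ w with splitAt a w
    ...   | inj₁ k = Px k
    ...   | inj₂ l = Py l

  record ProperParts {C : Set} (cz : Fin t → C) (cx : Fin a → C) (cy : Fin b → C) : Set where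
    field
      z-z : ∀ {i j} → i ≢ j → cz i ≢ cz j
      z-x : ∀ i k → cz i ≢ cx k
      z-y : ∀ i l → cz i ≢ cy l
      x-y : ∀ k l → cx k ≢ cy l

  open ProperParts public

  proper-parts : ∀ {C} {c : Fin (size G) → C} → Proper G c → ProperParts (c ∘ zv) (c ∘ xv) (c ∘ yv)
  proper-parts proper = record
    { z-z = λ i≢j → proper _ _ (adj-zz i≢j)
    ; z-x = λ i k → proper _ _ (adj-zx i k)
    ; z-y = λ i l → proper _ _ (adj-zy i l)
    ; x-y = λ k l → proper _ _ (adj-xy k l)
    }

  fromParts-proper : ∀ {C} (cz : Fin t → C) cx cy → ProperParts cz cx cy → Proper G (fromParts cz cx cy)
  fromParts-proper _ _ _ parts u v adj with splitAt t u | splitAt t v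
  ... | inj₁ i | inj₁ j = z-z parts adj
  ... | inj₁ i | inj₂ w with splitAt a w
  ...   | inj₁ k = z-x parts i k
  ...   | inj₂ l = z-y parts i l
  fromParts-proper _ _ _ parts u v adj | inj₂ w | inj₁ i with splitAt a w
  ...   | inj₁ k = z-x parts i k ∘ sym
  ...   | inj₂ l = z-y parts i l ∘ sym
  fromParts-proper _ _ _ parts u v adj | inj₂ w | inj₂ w′ with splitAt a w | splitAt a w′
  ...   | inj₁ k | inj₁ _ = ⊥-elim adj
  ...   | inj₁ k | inj₂ l = x-y parts k l
  ...   | inj₂ l | inj₁ k = x-y parts k l ∘ sym
  ...   | inj₂ l | inj₂ _ = ⊥-elim adj

  colourable : ∀ {k} (cz : Fin t → Fin k) cx cy → ProperParts cz cx cy → Colorable G k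
  colourable cz cx cy parts = fromParts cz cx cy , fromParts-proper cz cx cy parts

  ListColouring : (Fin (size G) → List ℕ) → Set
  ListColouring L = Σ (Fin (size G) → ℕ) λ c → Proper G c × (∀ v → c v ∈ L v)

  record Precolouring (L : Fin (size G) → List ℕ) (S : List ℕ) : Set where
    field
      cz   : Fin t → ℕ
      cx   : Fin a → ℕ
      cz∈L : ∀ i → cz i ∈ L (zv i)
      cx∈L : ∀ k → cx k ∈ L (xv k)
      cz∈S : ∀ i → cz i ∈ S
      cx∈S : ∀ k → cx k ∈ S
      zz   : ∀ {i j} → i ≢ j → cz i ≢ cz j
      zx   : ∀ i k → cz i ≢ cx k

  extend : ∀ {L S} → Precolouring L S → (∀ l → L (yv l) ⊈ S) → ListColouring L
  extend {L} {S} P free =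
    fromParts cz cx cy ,
    fromParts-proper cz cx cy (record
      { z-z = zz ; z-x = zx
      ; z-y = λ i l eq → avoids l (subst (_∈ S) eq (cz∈S i))
      ; x-y = λ k l eq → avoids l (subst (_∈ S) eq (cx∈S k)) }) ,
    vertex-elim (λ v → fromParts cz cx cy v ∈ L v)
      (λ i → subst (_∈ L (zv i)) (sym (fromParts-zv cz cx cy i)) (cz∈L i))
      (λ k → subst (_∈ L (xv k)) (sym (fromParts-xv cz cx cy k)) (cx∈L k))
      (λ l → subst (_∈ L (yv l)) (sym (fromParts-yv cz cx cy l)) (proj₁ (proj₂ (free l))))
    where
    open Precolouring P
    cy : Fin b → ℕ
    cy l = proj₁ (free l)
    avoids : ∀ l → cy l ∉ S
    avoids l = proj₂ (proj₂ (free l))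

  module _ {k} (Ez : Fin t → Fin k → ℕ) (Ex : Fin a → Fin k → ℕ) (Ey : Fin b → Fin k → ℕ) where

    enumLists : Fin (size G) → List ℕ
    enumLists = fromParts (tabulate ∘ Ez) (tabulate ∘ Ex) (tabulate ∘ Ey)

    choose-from-enumerations :
      (∀ i → Injective _≡_ _≡_ (Ez i)) → (∀ j → Injective _≡_ _≡_ (Ex j)) →
      (∀ l → Injective _≡_ _≡_ (Ey l)) → Choosable G k →
      Σ (Fin t → Fin k) λ rz → Σ (Fin a → Fin k) λ rx → Σ (Fin b → Fin k) λ ry →
        ProperParts (λ i → Ez i (rz i)) (λ j → Ex j (rx j)) (λ l → Ey l (ry l))
    choose-from-enumerations Ez-injective Ex-injective Ey-injective choosable = rz , rx , ry , record
      { z-z = λ i≢j → z-z parts i≢j ∘ transport (ez _) (ez _)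
      ; z-x = λ i j → z-x parts i j ∘ transport (ez i) (ex j)
      ; z-y = λ i l → z-y parts i l ∘ transport (ez i) (ey l)
      ; x-y = λ j l → x-y parts j l ∘ transport (ex j) (ey l)
      }
      where
      colouring : ListColouring enumLists
      colouring = choosable enumLists
        (fromParts-all _ _ _ Unique
          (tabulate⁺ ∘ Ez-injective) (tabulate⁺ ∘ Ex-injective) (tabulate⁺ ∘ Ey-injective))
        (fromParts-all _ _ _ (λ xs → length xs ≡ k)
          (λ _ → length-tabulate _) (λ _ → length-tabulate _) (λ _ → length-tabulate _))
      c : Fin (size G) → ℕ
      c = proj₁ colouring
      parts : ProperParts (c ∘ zv) (c ∘ xv) (c ∘ yv)
      parts = proper-parts (proj₁ (proj₂ colouring))
      picked : ∀ {v} {E : Fin k → ℕ} → enumLists v ≡ tabulate E → ∃ λ r → c v ≡ E r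
      picked {v} eq = ∈-tabulate⁻ (subst (c v ∈_) eq (proj₂ (proj₂ colouring) v))
      rz : Fin t → Fin k
      rz i = proj₁ (picked (fromParts-zv _ _ _ i))
      rx : Fin a → Fin k
      rx j = proj₁ (picked (fromParts-xv _ _ _ j))
      ry : Fin b → Fin k
      ry l = proj₁ (picked (fromParts-yv _ _ _ l))
      ez : ∀ i → c (zv i) ≡ Ez i (rz i)
      ez i = proj₂ (picked (fromParts-zv _ _ _ i))
      ex : ∀ j → c (xv j) ≡ Ex j (rx j)
      ex j = proj₂ (picked (fromParts-xv _ _ _ j))
      ey : ∀ l → c (yv l) ≡ Ey l (ry l)
      ey l = proj₂ (picked (fromParts-yv _ _ _ l))
      transport : ∀ {u v x y : ℕ} → u ≡ x → v ≡ y → x ≡ y → u ≡ v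
      transport u≡x v≡y x≡y = trans u≡x (trans x≡y (sym v≡y))

chromatic-K₀∨Kab : ∀ a b → IsChromaticNumber (K 0 ∨G Kbip (suc a) (suc b)) 2
chromatic-K₀∨Kab a b =
  colourable (λ ()) (λ _ → zero) (λ _ → suc zero)
    (record { z-z = λ { {()} } ; z-x = λ () ; z-y = λ () ; x-y = λ _ _ () }) ,
  λ j (c , proper) → 2≤-of-≢ (x-y (proper-parts proper) zero zero)
  where open Join 0 (suc a) (suc b)

chromatic-K₁∨Kab : ∀ a b → IsChromaticNumber (K 1 ∨G Kbip (suc a) (suc b)) 3
chromatic-K₁∨Kab a b =
  colourable (λ _ → zero) (λ _ → suc zero) (λ _ → suc (suc zero))
    (record { z-z = λ { {zero} {zero} 0≢0 → contradiction refl 0≢0 }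
            ; z-x = λ _ _ () ; z-y = λ _ _ () ; x-y = λ _ _ () }) ,
  λ j (c , proper) → let parts = proper-parts proper in
    3≤-of-≢ (z-x parts zero zero) (z-y parts zero zero) (x-y parts zero zero)
  where open Join 1 (suc a) (suc b)

-- K_{a,b} is a-choosable exactly when b < a^a

choosable-Kab : ∀ {a b} → b < a ^ a → Choosable (Kbip a b) a
choosable-Kab {a} {b} b<aᵃ L unique length≡ = [ overlapping , disjoint ]′ (overlap-or-disjoint X)
  where
  open Join 0 a b
  X : Fin a → Fin a → ℕ
  X k = enumerate (L (xv k)) (length≡ (xv k))
  precolouring : ∀ ch {T} → (∀ k → X k (ch k) ∈ T) → Precolouring L T
  precolouring ch ∈T = record
    { cz = λ () ; cx = λ k → X k (ch k) ; cz∈L = λ () ; cx∈L = λ k → enumerate-∈ _ (length≡ (xv k)) (ch k)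
    ; cz∈S = λ () ; cx∈S = ∈T ; zz = λ { {()} } ; zx = λ () }
  overlapping : RowsOverlap X → ListColouring L
  overlapping rows-meet =
    let ch , T , T<a , ∈T = overlap⇒short-transversal X rows-meet
    in extend (precolouring ch ∈T) λ l →
         ⊈-of-length< (unique (yv l)) (subst (length T <_) (sym (length≡ (yv l))) T<a)
  disjoint : RowsDisjoint X → ListColouring L
  disjoint rows-disjoint =
    let u , free = uncovered-of-injective S (L ∘ yv) (unique ∘ yv) S-short b<aᵃ S-injective
    in extend (precolouring (finToFun u) (∈-transversal⁺ X (finToFun u))) free
    where
    S : Fin (a ^ a) → List ℕ
    S u = transversal X (finToFun u)
    S-short : ∀ u l → length (S u) ≤ length (L (yv l))
    S-short u l = ≤-reflexive (trans (length-transversal X (finToFun u)) (sym (length≡ (yv l))))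
    X-injective : ∀ k → Injective _≡_ _≡_ (X k)
    X-injective k = enumerate-injective (length≡ (xv k)) (unique (xv k))
    S-injective : ∀ {u v} → S u ≋ S v → u ≡ v
    S-injective (Su⊆Sv , _) = finToFun-injective (transversal-injective X X-injective rows-disjoint Su⊆Sv)

not-choosable-Kab : ∀ t {a b} → a ^ a ≤ b → ¬ Choosable (K t ∨G Kbip a b) a
not-choosable-Kab t {a} {b} aᵃ≤b choosable =
  let rz , rx , ry , parts = choose-from-enumerations Ez Ex Ey (λ _ → Finₚ.toℕ-injective)
        (λ j → proj₂ ∘ cell-injective {i = j} {k = j}) (λ _ → proj₁ ∘ cell-injective {m = a}) choosable
      l = inject≤ (funToFin rx) aᵃ≤b
  in x-y parts (ry l) l (cong (cell (ry l)) (sym (decodes rx (ry l))))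
  where
  open Join t a b
  instance
    aᵃ≢0 : NonZero (a ^ a)
    aᵃ≢0 = nⁿ≢0 a
  -- Any lists do on K_t: the conflict arises between the x's and the y's.
  Ez : Fin t → Fin a → ℕ
  Ez _ = toℕ
  Ex : Fin a → Fin a → ℕ
  Ex = cell
  Ey : Fin b → Fin a → ℕ
  Ey l k = cell k (finToFun {a} {a} (clamp l) k)
  decodes : ∀ h k → finToFun {a} {a} (clamp (inject≤ (funToFin h) aᵃ≤b)) k ≡ h k
  decodes h k = trans (cong (λ u → finToFun u k) (clamp-inject≤ (funToFin h) aᵃ≤b)) (Finₚ.finToFun-funToFin h k)

-- K_1 ∨ K_{a,b} is (a+1)-choosable exactly when b < C(a+1,2)·(a+1)^(a-1)

-- The configurations of the upper bound, for disjoint rows X of the x-lists: a colour Z j for the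
-- apex, then in the row containing Z j (if any) one of the other entries, indexed by i, and the
-- entries g elsewhere.
module Avoidance {m} (Z : Fin (2 + m) → ℕ) (X : Fin (suc m) → Fin (2 + m) → ℕ)
                 (Z-injective : Injective _≡_ _≡_ Z) (X-injective : ∀ k → Injective _≡_ _≡_ (X k))
                 (disjoint : RowsDisjoint X) where

  Located : ℕ → Set
  Located w = ∃₂ λ k p → X k p ≡ w

  locate : ∀ w → Dec (Located w)
  locate w = Finₚ.any? λ k → Finₚ.any? λ p → X k p ≟ w

  avoiding : ∀ {w} → Dec (Located w) → Fin (suc m) → (Fin m → Fin (2 + m)) → Fin (suc m) → Fin (2 + m)
  avoiding (yes (k , p , _)) i g = insertAt g k (punchIn p i)
  avoiding (no _)            i g = insertAt g zero (punchIn zero i)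

  avoiding-avoids : ∀ {w} (d : Dec (Located w)) i g k → X k (avoiding d i g k) ≢ w
  avoiding-avoids (yes (k₀ , p₀ , at)) i g k eq with refl ← disjoint (trans eq (sym at)) =
    Finₚ.punchInᵢ≢i p₀ i (trans (sym (insertAt-lookup g k₀ _)) (X-injective k₀ (trans eq (sym at))))
  avoiding-avoids (no unlocated) i g k eq = unlocated (k , _ , eq)

  avoiding-injective : ∀ {w} (d : Dec (Located w)) {i i′ g g′} →
                       (∀ k → avoiding d i g k ≡ avoiding d i′ g′ k) → i ≡ i′ × (∀ k → g k ≡ g′ k)
  avoiding-injective (yes (k , p , _)) same =
    Product.map₁ (Finₚ.punchIn-injective p _ _) (insertAt-injective _ _ k same)
  avoiding-injective (no _) same =
    Product.map₁ (Finₚ.punchIn-injective zero _ _) (insertAt-injective _ _ zero same)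

  Config : Set
  Config = Fin (2 + m) × Fin (suc m) × Fin ((2 + m) ^ m)

  choice : Config → Fin (suc m) → Fin (2 + m)
  choice (j , i , code) = avoiding (locate (Z j)) i (finToFun code)

  colours : Config → List ℕ
  colours c@(j , _) = Z j ∷ transversal X (choice c)

  choice-avoids : ∀ c k → X k (choice c k) ≢ Z (proj₁ c)
  choice-avoids (j , i , code) = avoiding-avoids (locate (Z j)) i (finToFun code)

  ∈-colours : ∀ c {k p} → X k p ∈ colours c → X k p ≡ Z (proj₁ c) ⊎ p ≡ choice c k
  ∈-colours c (here eq) = inj₁ eq
  ∈-colours c {k} (there x∈)
    with k′ , eq ← ∈-transversal⁻ X (choice c) x∈
    with refl ← disjoint {k} {k′} eq
    = inj₂ (X-injective _ eq)

  same-apex : ∀ {c c′} → colours c ⊆ colours c′ → Z (proj₁ c) ≡ Z (proj₁ c′) → c ≡ c′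
  same-apex {c@(j , i , code)} {j′ , i′ , code′} ⊆c′ z≡z′ with refl ← Z-injective z≡z′ =
    let i≡i′ , g≗g′ = avoiding-injective (locate (Z j)) λ k →
          [ ⊥-elim ∘ choice-avoids c k , id ]′ (∈-colours _ (⊆c′ (there (∈-transversal⁺ X (choice c) k))))
    in cong₂ (λ i code → j , i , code) i≡i′ (finToFun-injective g≗g′)

  crossing : ∀ {c c′} → colours c′ ⊆ colours c → Z (proj₁ c′) ≢ Z (proj₁ c) →
             ∃ λ k → Z (proj₁ c′) ≡ X k (choice c k) × X k (choice c′ k) ≡ Z (proj₁ c)
  crossing {c} {c′} ⊆c z′≢z with ⊆c (here refl)
  ... | here eq = contradiction eq z′≢z
  ... | there z′∈
    with k , eq ← ∈-transversal⁻ X (choice c) z′∈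
    = k , eq , [ id , (λ same → contradiction (trans (cong (X k) same) (sym eq)) (choice-avoids c′ k)) ]′
                   (∈-colours c (⊆c (there (∈-transversal⁺ X (choice c′) k))))

  colours-two-to-one : ∀ {c c′ c″} → colours c ≋ colours c′ → colours c ≋ colours c″ →
                       c ≡ c′ ⊎ c ≡ c″ ⊎ c′ ≡ c″
  colours-two-to-one {c} {c′} {c″} (⊆c′ , c′⊆) (⊆c″ , c″⊆)
    with Z (proj₁ c) ≟ Z (proj₁ c′) | Z (proj₁ c) ≟ Z (proj₁ c″)
  ... | yes z≡z′ | _        = inj₁ (same-apex ⊆c′ z≡z′)
  ... | no _     | yes z≡z″ = inj₂ (inj₁ (same-apex ⊆c″ z≡z″))
  ... | no z≢z′  | no z≢z″
    with k′ , z′≡ , ≡z ← crossing c′⊆ (z≢z′ ∘ sym)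
    with k″ , z″≡ , ≡z′ ← crossing c″⊆ (z≢z″ ∘ sym)
    with refl ← disjoint (trans ≡z (sym ≡z′))
    = inj₂ (inj₂ (same-apex (⊆c″ ∘ c′⊆) (trans z′≡ (sym z″≡))))

double-threshold : ∀ m → 2 * (((2 + m) C 2) * (2 + m) ^ m) ≡ (2 + m) * (suc m * (2 + m) ^ m)
double-threshold m = begin
  2 * (((2 + m) C 2) * (2 + m) ^ m)   ≡⟨ *-assoc 2 ((2 + m) C 2) ((2 + m) ^ m) ⟨
  2 * ((2 + m) C 2) * (2 + m) ^ m     ≡⟨ cong (λ x → 2 * x * (2 + m) ^ m) (pairs≡C2 (2 + m)) ⟨
  2 * pairs (2 + m) * (2 + m) ^ m     ≡⟨ cong (_* (2 + m) ^ m) (double-pairs (suc m)) ⟩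
  (2 + m) * suc m * (2 + m) ^ m       ≡⟨ *-assoc (2 + m) (suc m) _ ⟩
  (2 + m) * (suc m * (2 + m) ^ m)     ∎
  where open ≡-Reasoning

choosable-K₁∨Kab : ∀ m {b} → b < ((2 + m) C 2) * (2 + m) ^ m → Choosable (K 1 ∨G Kbip (suc m) b) (2 + m)
choosable-K₁∨Kab m {b} b<N L unique length≡ = [ overlapping , disjoint ]′ (overlap-or-disjoint X)
  where
  open Join 1 (suc m) b
  A = 2 + m
  Lz = L (zv zero)
  X : Fin (suc m) → Fin A → ℕ
  X k = enumerate (L (xv k)) (length≡ (xv k))
  precolouring : ∀ {w} → w ∈ Lz → ∀ ch → (∀ k → w ≢ X k (ch k)) →
                 ∀ {T} → (∀ k → X k (ch k) ∈ T) → Precolouring L (w ∷ T)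
  precolouring {w} w∈Lz ch w≢ ∈T = record
    { cz = λ _ → w ; cx = λ k → X k (ch k)
    ; cz∈L = λ { zero → w∈Lz } ; cx∈L = λ k → enumerate-∈ _ (length≡ (xv k)) (ch k)
    ; cz∈S = λ _ → here refl ; cx∈S = there ∘ ∈T
    ; zz = λ { {zero} {zero} 0≢0 → contradiction refl 0≢0 } ; zx = λ _ → w≢ }
  overlapping : RowsOverlap X → ListColouring L
  overlapping rows-meet =
    let ch , T , T<a , ∈T = overlap⇒short-transversal X rows-meet
        w , w∈Lz , w∉T = ⊈-of-length< (unique (zv zero))
                           (subst (length T <_) (sym (length≡ (zv zero))) (m≤n⇒m≤1+n T<a))
    in extend (precolouring w∈Lz ch (λ k w≡ → w∉T (subst (_∈ T) (sym w≡) (∈T k))) ∈T)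
              (λ l → ⊈-of-length< (unique (yv l)) (subst (length (w ∷ T) <_) (sym (length≡ (yv l))) (s≤s T<a)))
  disjoint : RowsDisjoint X → ListColouring L
  disjoint rows-disjoint =
    let u , free = uncovered-of-two-to-one S (L ∘ yv) (unique ∘ yv) S-short 2b<N S-two-to-one
        c = decode u
    in extend (precolouring (enumerate-∈ Lz (length≡ (zv zero)) _) (choice c) (λ k → choice-avoids c k ∘ sym)
                            (∈-transversal⁺ X (choice c)))
              free
    where
    open Avoidance (enumerate Lz (length≡ (zv zero))) X (enumerate-injective (length≡ (zv zero)) (unique (zv zero)))
                   (λ k → enumerate-injective (length≡ (xv k)) (unique (xv k))) rows-disjoint
    decode : Fin (A * (suc m * A ^ m)) → Config
    decode = remQuot₃ (A ^ m)
    S : Fin (A * (suc m * A ^ m)) → List ℕ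
    S = colours ∘ decode
    S-short : ∀ u l → length (S u) ≤ length (L (yv l))
    S-short u l = ≤-reflexive (trans (cong suc (length-transversal X (choice (decode u)))) (sym (length≡ (yv l))))
    2b<N : 2 * b < A * (suc m * A ^ m)
    2b<N = subst (2 * b <_) (double-threshold m) (*-monoʳ-< 2 b<N)
    S-two-to-one : ∀ {u v w} → S u ≋ S v → S u ≋ S w → u ≡ v ⊎ u ≡ w ⊎ v ≡ w
    S-two-to-one Su≋Sv Su≋Sw = Sum.map injective (Sum.map injective injective) (colours-two-to-one Su≋Sv Su≋Sw)
      where injective = remQuot₃-injective (A ^ m)

-- The list, in the lower bound, of colours p and q of the common row 0 of z and x₀, and g k of row k + 1.
blocker : ∀ {m} → Fin (2 + m) × Fin (2 + m) → (Fin m → Fin (2 + m)) → Fin (2 + m) → ℕ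
blocker {m} (p , q) g zero          = cell {suc m} zero p
blocker {m} (p , q) g (suc zero)    = cell {suc m} zero q
blocker     (p , q) g (suc (suc k)) = cell (suc k) (g k)

blocker-injective : ∀ {m} x (g : Fin m → Fin (2 + m)) → proj₁ x ≢ proj₂ x →
                    Injective _≡_ _≡_ (blocker x g)
blocker-injective x g p≢q {zero}        {zero}        _  = refl
blocker-injective x g p≢q {zero}        {suc zero}    eq = contradiction (proj₂ (cell-injective eq)) p≢q
blocker-injective x g p≢q {zero}        {suc (suc _)} eq = contradiction (proj₁ (cell-injective eq)) λ ()
blocker-injective x g p≢q {suc zero}    {zero}        eq = contradiction (sym (proj₂ (cell-injective eq))) p≢q
blocker-injective x g p≢q {suc zero}    {suc zero}    _  = refl
blocker-injective x g p≢q {suc zero}    {suc (suc _)} eq = contradiction (proj₁ (cell-injective eq)) λ ()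
blocker-injective x g p≢q {suc (suc _)} {zero}        eq = contradiction (proj₁ (cell-injective eq)) λ ()
blocker-injective x g p≢q {suc (suc _)} {suc zero}    eq = contradiction (proj₁ (cell-injective eq)) λ ()
blocker-injective x g p≢q {suc (suc _)} {suc (suc _)} eq =
  cong (λ k → suc (suc k)) (Finₚ.suc-injective (proj₁ (cell-injective eq)))

blocker-cong : ∀ {m} x {g g′ : Fin m → Fin (2 + m)} → (∀ k → g k ≡ g′ k) →
               ∀ e → blocker x g e ≡ blocker x g′ e
blocker-cong x g≗g′ zero          = refl
blocker-cong x g≗g′ (suc zero)    = refl
blocker-cong x g≗g′ (suc (suc k)) = cong (cell (suc k)) (g≗g′ k)

blocker-used : ∀ {m} {x} {r₀ : Fin (2 + m)} (r : Fin (suc m) → Fin (2 + m)) →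
               x ≡ (r₀ , r zero) ⊎ x ≡ (r zero , r₀) →
               ∀ e → blocker x (r ∘ suc) e ≡ cell {suc m} zero r₀ ⊎ ∃ λ j → blocker x (r ∘ suc) e ≡ cell j (r j)
blocker-used r (inj₁ refl) zero          = inj₁ refl
blocker-used r (inj₁ refl) (suc zero)    = inj₂ (zero , refl)
blocker-used r (inj₂ refl) zero          = inj₂ (zero , refl)
blocker-used r (inj₂ refl) (suc zero)    = inj₁ refl
blocker-used r _           (suc (suc k)) = inj₂ (suc k , refl)

not-choosable-K₁∨Kab : ∀ m {b} → ((2 + m) C 2) * (2 + m) ^ m ≤ b →
                       ¬ Choosable (K 1 ∨G Kbip (suc m) b) (2 + m)
not-choosable-K₁∨Kab m {b} N≤b choosable =
  let rz , rx , ry , parts = choose-from-enumerations Ez Ex Ey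
        (λ _ → proj₂ ∘ cell-injective {i = zero} {k = zero {m}})
        (λ j → proj₂ ∘ cell-injective {i = j} {k = j})
        (λ l → blocker-injective (pair A (proj₁ (decode l))) _ (pair-distinct A (proj₁ (decode l))))
        choosable
      u , u-pair = pair-surjective (z-x parts zero zero ∘ cong (Ex zero))
      l = inject≤ (combine u (funToFin (rx ∘ suc))) N≤b′
  in [ z-y parts zero l ∘ sym , (λ (j , eq) → x-y parts j l (sym eq)) ]′ (reads-used rx u u-pair (ry l))
  where
  open Join 1 (suc m) b
  A = 2 + m
  N = pairs A * A ^ m
  instance
    N≢0 : NonZero N
    N≢0 = m*n≢0 (pairs A) (A ^ m) {{_}} {{m^n≢0 A m}}
  N≤b′ : N ≤ b
  N≤b′ = subst (λ x → x * A ^ m ≤ b) (sym (pairs≡C2 A)) N≤b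
  decode : Fin b → Fin (pairs A) × Fin (A ^ m)
  decode l = remQuot (A ^ m) (clamp l)
  Ex : Fin (suc m) → Fin A → ℕ
  Ex = cell
  Ez : Fin 1 → Fin A → ℕ
  Ez _ = Ex zero
  Ey : Fin b → Fin A → ℕ
  Ey l = blocker (pair A (proj₁ (decode l))) (finToFun (proj₂ (decode l)))
  reads-used : ∀ {rz} (rx : Fin (suc m) → Fin A) u → pair A u ≡ (rz , rx zero) ⊎ pair A u ≡ (rx zero , rz) →
               let l = inject≤ (combine u (funToFin (rx ∘ suc))) N≤b′ in
               ∀ e → Ey l e ≡ Ex zero rz ⊎ ∃ λ j → Ey l e ≡ Ex j (rx j)
  reads-used {rz} rx u u-pair e =
    subst (λ y → y ≡ Ex zero rz ⊎ ∃ λ j → y ≡ Ex j (rx j)) (sym decodes) (blocker-used rx u-pair e)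
    where
    code : Fin (A ^ m)
    code = funToFin (rx ∘ suc)
    decodes : Ey (inject≤ (combine u code) N≤b′) e ≡ blocker (pair A u) (rx ∘ suc) e
    decodes = trans
      (cong (λ (v , code′) → blocker (pair A v) (finToFun code′) e)
            (trans (cong (remQuot (A ^ m)) (clamp-inject≤ (combine u code) N≤b′)) (Finₚ.remQuot-combine u code)))
      (blocker-cong (pair A u) (Finₚ.finToFun-funToFin (rx ∘ suc)) e)

theorem12 : (s b : ℕ) → 1 ≤ b →
    IsTau s (s + 2) b 1 ⇔
      (((s + 2) ^ (s + 2) ≤ b) × (b ≤ ((s + 3) C 2) * (s + 3) ^ (s + 1) ∸ 1))
theorem12 s zero    ()
theorem12 s (suc b) _ rewrite +-comm s 2 | +-comm s 3 | +-comm s 1 = mk⇔ to from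
  where
  a = 2 + s
  N = ((3 + s) C 2) * (3 + s) ^ suc s
  χ₀ : IsChromaticNumber (K 0 ∨G Kbip a (suc b)) 2
  χ₀ = chromatic-K₀∨Kab (suc s) b
  χ₁ : IsChromaticNumber (K 1 ∨G Kbip a (suc b)) 3
  χ₁ = chromatic-K₁∨Kab (suc s) b
  to : IsTau s a (suc b) 1 → (a ^ a ≤ suc b) × (suc b ≤ N ∸ 1)
  to (gap₁ , ¬gap₀) =
    ≮⇒≥ (λ b<aᵃ → choosable⇒¬¬gap χ₀ (choosable-Kab b<aᵃ) (¬gap₀ 0 (s≤s z≤n))) ,
    <⇒≤pred {suc b} {N} (≰⇒> λ N≤b → not-choosable-K₁∨Kab (suc s) N≤b (gap⇒choosable χ₁ gap₁))
  from : (a ^ a ≤ suc b) × (suc b ≤ N ∸ 1) → IsTau s a (suc b) 1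
  from (aᵃ≤b , b≤N∸1) =
    (3 , 3 + s , χ₁ ,
     listChromatic-of-least (choosable-K₁∨Kab (suc s) (pred-cancel-< {suc b} {N} b≤N∸1))
                            (not-choosable-Kab 1 aᵃ≤b) ,
     ≤-refl) ,
    λ { zero _ gap₀ → not-choosable-Kab 0 aᵃ≤b (gap⇒choosable χ₀ gap₀) ; (suc _) (s≤s ()) }
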